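{- Let $\langle S,T\rangle$ be a Rec program and $M$ the set of procedures declared in $T$. Let $\rho:M\to 2^{\mathbf{State}^+}$ be an arbitrary interpretation of the procedures, and let $\mathcal{V}_\rho$ be the valuation of recursion variables with $\mathcal{V}_\rho(X_m)=\rho(m)$ for $m\in M$. Then for every Rec statement $S$, $[\![\widehat{\mathsf{stf}}(S)]\!]_{\mathcal{V}_\rho}=\mathcal{S}_{tr}[\![S]\!]_\rho$.
   Context: Rec statements: $S ::= \mathbf{skip} \mid x := a \mid S_1;S_2 \mid \mathbf{if}\ b\ \mathbf{then}\ S_1\ \mathbf{else}\ S_2 \mid m()$ with $a,b$ side-effect-free arithmetic/Boolean expressions over global integer variables and $m$ procedures declared in $T$. $\mathbf{State}$ = maps from variables to $\mathbb{Z}$; $\mathbf{State}^+$ = nonempty finite state sequences. For $A,B\subseteq\mathbf{State}^+$: $A|_b=\{s\cdot\sigma\in A:\mathcal{B}[\![b]\!](s)=\mathbf{tt}\}$, $\sharp A=\{s\cdot s\cdot\sigma:s\cdot\sigma\in A\}$, $A\frown B=\{\sigma_A\cdot s\cdot\sigma_B:\sigma_A\cdot s\in A,s\cdot\sigma_B\in B\}$. Relativized semantics: $\mathcal{S}_{tr}[\![\mathbf{skip}]\!]_\rho=\{s\cdot s\}$, $\mathcal{S}_{tr}[\![x:=a]\!]_\rho=\{s\cdot s[x\mapsto\mathcal{A}[\![a]\!](s)]\}$, $\mathcal{S}_{tr}[\![S_1;S_2]\!]_\rho=\mathcal{S}_{tr}[\![S_1]\!]_\rho\frown\mathcal{S}_{tr}[\![S_2]\!]_\rho$,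 $\mathcal{S}_{tr}[\![\mathbf{if}\ b\ \mathbf{then}\ S_1\ \mathbf{else}\ S_2]\!]_\rho=(\sharp\mathcal{S}_{tr}[\![S_1]\!]_\rho)|_b\cup(\sharp\mathcal{S}_{tr}[\![S_2]\!]_\rho)|_{\neg b}$, $\mathcal{S}_{tr}[\![m()]\!]_\rho=\rho(m)$. Trace formulas: $\phi ::= p \mid R \mid X \mid \phi_1\wedge\phi_2 \mid \phi_1\vee\phi_2 \mid \phi_1\frown\phi_2 \mid \mu X.\phi$ with $[\![p]\!]_{\mathcal{V}}=\{s\cdot\sigma:s\models p\}$ (state formulas include Boolean expressions), $[\![R]\!]_{\mathcal{V}}=\{s\cdot s':R(s,s')\}$, $[\![X]\!]_{\mathcal{V}}=\mathcal{V}(X)$, $\wedge,\vee,\frown$ as $\cap,\cup$, chop, $[\![\mu X.\phi]\!]_{\mathcal{V}}=\bigcap\{\gamma:[\![\phi]\!]_{\mathcal{V}[X\mapsto\gamma]}\subseteq\gamma\}$. $\mathit{Id}(s,s')$ iff $s'=s$; $\mathit{Sb}^a_x(s,s')$ iff $s'=s[x\mapsto\mathcal{A}[\![a]\!](s)]$. $\widehat{\mathsf{stf}}$: $\widehat{\mathsf{stf}}(\mathbf{skip})=\mathit{Id}$, $\widehat{\mathsf{stf}}(x:=a)=\mathit{Sb}^a_x$, $\widehat{\mathsf{stf}}(S_1;S_2)=\widehat{\mathsf{stf}}(S_1)\frown\widehat{\mathsf{stf}}(S_2)$, $\widehat{\mathsf{stf}}(\mathbf{if}\ b\ \mathbf{then}\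 S_1\ \mathbf{else}\ S_2)=(b\wedge(\mathit{Id}\frown\widehat{\mathsf{stf}}(S_1)))\vee(\neg b\wedge(\mathit{Id}\frown\widehat{\mathsf{stf}}(S_2)))$, and $\widehat{\mathsf{stf}}(m())=X_m$, where $X_m$ is a recursion variable associated with procedure $m$. -}

module Defs where

open import Level using (Level; Lift; lift; lower) renaming (suc to lsuc; zero to lzero)
open import Data.Nat using (ℕ)
open import Data.Fin using (Fin)
open import Data.Bool using (Bool; true; false; not; _∧_; _∨_; if_then_else_)
open import Data.Integer using (ℤ) renaming (_+_ to _+ℤ_; _-_ to _-ℤ_; _*_ to _*ℤ_)
import Data.Integer.Properties as ℤP
open import Data.List using (List; []; _∷_; _++_; _∷ʳ_)
open import Data.List.NonEmpty using (List⁺; _∷_; toList; head)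
open import Data.Product using (Σ; ∃; ∃-syntax; _×_; _,_)
open import Data.Sum using (_⊎_; inj₁; inj₂)
open import Relation.Binary.PropositionalEquality using (_≡_)
open import Relation.Nullary using (does; ¬_)
open import Data.Nat using () renaming (_≟_ to _≟ℕ_)

PVar : Set
PVar = ℕ

State : Set
State = PVar → ℤ

_[_↦_] : State → PVar → ℤ → State
(s [ x ↦ v ]) y = if does (x ≟ℕ y) then v else s y

Trace : Set
Trace = List⁺ State

TSet : Set₁
TSet = Trace → Set

data AExp : Set where
  num  : ℤ → AExp
  var  : PVar → AExp
  _⊕_  : AExp → AExp → AExp
  _⊖_  : AExp → AExp → AExp
  _⊛_  : AExp → AExp → AExp

data BExp : Set where
  tt ff : BExp
  _==_  : AExp → AExp → BExp
  _≤ₑ_  : AExp → AExp → BExp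
  ¬ₑ_   : BExp → BExp
  _∧ₑ_  : BExp → BExp → BExp

𝒜⟦_⟧ : AExp → State → ℤ
𝒜⟦ num n ⟧ s = n
𝒜⟦ var x ⟧ s = s x
𝒜⟦ a ⊕ b ⟧ s = 𝒜⟦ a ⟧ s +ℤ 𝒜⟦ b ⟧ s
𝒜⟦ a ⊖ b ⟧ s = 𝒜⟦ a ⟧ s -ℤ 𝒜⟦ b ⟧ s
𝒜⟦ a ⊛ b ⟧ s = 𝒜⟦ a ⟧ s *ℤ 𝒜⟦ b ⟧ s

ℬ⟦_⟧ : BExp → State → Bool
ℬ⟦ tt ⟧ s = true
ℬ⟦ ff ⟧ s = false
ℬ⟦ a == b ⟧ s = does (𝒜⟦ a ⟧ s ℤP.≟ 𝒜⟦ b ⟧ s)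
ℬ⟦ a ≤ₑ b ⟧ s = does (𝒜⟦ a ⟧ s ℤP.≤? 𝒜⟦ b ⟧ s)
ℬ⟦ ¬ₑ b ⟧ s = not (ℬ⟦ b ⟧ s)
ℬ⟦ b ∧ₑ c ⟧ s = ℬ⟦ b ⟧ s ∧ ℬ⟦ c ⟧ s

data Stmt (k : ℕ) : Set where
  skip    : Stmt k
  _≔_     : PVar → AExp → Stmt k
  _⨾_     : Stmt k → Stmt k → Stmt k
  ifS_then_else_ : BExp → Stmt k → Stmt k → Stmt k
  call    : Fin k → Stmt k

record Program (k : ℕ) : Set where
  field
    main  : Stmt k
    decls : Fin k → Stmt k

_∣ᵇ_ : TSet → BExp → TSet
(A ∣ᵇ b) t = A t × ℬ⟦ b ⟧ (head t) ≡ true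

♯ : TSet → TSet
♯ A t = Σ State λ s → Σ (List State) λ σ → A (s ∷ σ) × t ≡ s ∷ (s ∷ σ)

chopT : TSet → TSet → TSet
chopT A B t =
  Σ (List State) λ σA → Σ State λ s → Σ (List State) λ σB →
    Σ (List⁺ State) λ ta →
      toList ta ≡ σA ∷ʳ s × A ta × B (s ∷ σB) × toList t ≡ σA ++ (s ∷ σB)

Interp : ℕ → Set₁
Interp k = Fin k → TSet

𝒮tr⟦_⟧ : ∀ {k} → Stmt k → Interp k → TSet
𝒮tr⟦ skip ⟧ ρ t = Σ State λ s → t ≡ s ∷ (s ∷ [])
𝒮tr⟦ x ≔ a ⟧ ρ t = Σ State λ s → t ≡ s ∷ ((s [ x ↦ 𝒜⟦ a ⟧ s ]) ∷ [])
𝒮tr⟦ S₁ ⨾ S₂ ⟧ ρ = chopT (𝒮tr⟦ S₁ ⟧ ρ) (𝒮tr⟦ S₂ ⟧ ρ)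
𝒮tr⟦ ifS b then S₁ else S₂ ⟧ ρ t =
  ((♯ (𝒮tr⟦ S₁ ⟧ ρ)) ∣ᵇ b) t ⊎ ((♯ (𝒮tr⟦ S₂ ⟧ ρ)) ∣ᵇ (¬ₑ b)) t
𝒮tr⟦ call m ⟧ ρ = ρ m

-- Trace formulas.  Recursion variables: X_m (m : Fin k) and further
-- variables indexed by ℕ (for μ-binders etc.).

RVar : ℕ → Set
RVar k = Fin k ⊎ ℕ

X_ : ∀ {k} → Fin k → RVar k
X m = inj₁ m

_≟RV_ : ∀ {k} (x y : RVar k) → Bool
inj₁ m ≟RV inj₁ n = does (m Data.Fin.≟ n)
inj₂ i ≟RV inj₂ j = does (i ≟ℕ j)
_ ≟RV _ = false

data Formula (k : ℕ) : Set₁ where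
  st   : (State → Set) → Formula k
  rel  : (State → State → Set) → Formula k
  var  : RVar k → Formula k
  _∧ᶠ_ _∨ᶠ_ _⌢ᶠ_ : Formula k → Formula k → Formula k
  μ    : RVar k → Formula k → Formula k

bᶠ : ∀ {k} → BExp → Formula k
bᶠ b = st (λ s → ℬ⟦ b ⟧ s ≡ true)

Valuation : ℕ → Set₁
Valuation k = RVar k → TSet

_[_≔ᵛ_] : ∀ {k} → Valuation k → RVar k → TSet → Valuation k
(V [ X ≔ᵛ γ ]) Y = if X ≟RV Y then γ else V Y

-- ⟦φ⟧_V.  Sets of traces are Set-valued predicates; the least fixed point
-- is the intersection over all such sets γ closed under φ (so the
-- denotation lives one universe up, Set₁).
⟦_⟧ : ∀ {k} → Formula k → Valuation k → Trace → Set₁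
⟦ st p ⟧ V t = Lift (lsuc lzero) (p (head t))
⟦ rel R ⟧ V t = Lift (lsuc lzero)
  (Σ State λ s → Σ State λ s' → t ≡ s ∷ (s' ∷ []) × R s s')
⟦ var X ⟧ V t = Lift (lsuc lzero) (V X t)
⟦ φ ∧ᶠ ψ ⟧ V t = ⟦ φ ⟧ V t × ⟦ ψ ⟧ V t
⟦ φ ∨ᶠ ψ ⟧ V t = ⟦ φ ⟧ V t ⊎ ⟦ ψ ⟧ V t
⟦ φ ⌢ᶠ ψ ⟧ V t =
  Σ (List State) λ σA → Σ State λ s → Σ (List State) λ σB →
    Σ (List⁺ State) λ ta →
      Lift (lsuc lzero) (toList ta ≡ σA ∷ʳ s) × ⟦ φ ⟧ V ta × ⟦ ψ ⟧ V (s ∷ σB)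
      × Lift (lsuc lzero) (toList t ≡ σA ++ (s ∷ σB))
⟦ μ X φ ⟧ V t =
  (γ : TSet) → (∀ u → ⟦ φ ⟧ (V [ X ≔ᵛ γ ]) u → γ u) → Lift (lsuc lzero) (γ t)

Id : State → State → Set
Id s s' = s' ≡ s

Sb : PVar → AExp → State → State → Set
Sb x a s s' = s' ≡ s [ x ↦ 𝒜⟦ a ⟧ s ]

stf̂ : ∀ {k} → Stmt k → Formula k
stf̂ skip = rel Id
stf̂ (x ≔ a) = rel (Sb x a)
stf̂ (S₁ ⨾ S₂) = stf̂ S₁ ⌢ᶠ stf̂ S₂
stf̂ (ifS b then S₁ else S₂) =
  (bᶠ b ∧ᶠ (rel Id ⌢ᶠ stf̂ S₁)) ∨ᶠ (bᶠ (¬ₑ b) ∧ᶠ (rel Id ⌢ᶠ stf̂ S₂))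
stf̂ (call m) = var (X m)

_≐_ : (Trace → Set₁) → TSet → Set₁
A ≐ B = ∀ t → (A t → B t) × (B t → A t)

{-# OPTIONS --safe #-}
-- Structural induction on S, where each clause of stf̂ denotes the matching
-- clause of 𝒮tr: Id and Sb are graphs of state transformers, so they denote the
-- two-state traces of skip and x := a; ⌢ᶠ is chop; and chopping the diagonal Id
-- in front of φ repeats the first state, i.e. it is ♯.
module Submission where

open import Defs
open import Data.Nat using (ℕ)
open import Data.List using ([]; _∷_)
open import Data.List.Properties using (∷ʳ-injective)
open import Data.List.NonEmpty using (_∷_)
open import Data.Product using (Σ; _,_; proj₁; proj₂)
import Data.Sum as Sum
open import Data.Sum using (_⊎_)
open import Level using (lift; lower)
open import Relation.Binary.PropositionalEquality using (_≡_; refl)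

module _ {k : ℕ} (V : Valuation k) where

  ⟦rel-graph⟧ : (f : State → State) →
    ⟦ rel (λ s s′ → s′ ≡ f s) ⟧ V ≐ λ t → Σ State λ s → t ≡ s ∷ f s ∷ []
  ⟦rel-graph⟧ f t =
    (λ { (lift (s , _ , refl , refl)) → s , refl }) ,
    (λ { (s , refl) → lift (s , f s , refl , refl) })

  ⟦var⟧ : ∀ {X A} → V X ≡ A → ⟦ var X ⟧ V ≐ A
  ⟦var⟧ refl t = lower , lift

  ⟦∨ᶠ⟧ : ∀ {φ ψ A B} → ⟦ φ ⟧ V ≐ A → ⟦ ψ ⟧ V ≐ B →
    ⟦ φ ∨ᶠ ψ ⟧ V ≐ λ t → A t ⊎ B t
  ⟦∨ᶠ⟧ φ≐A ψ≐B t =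
    Sum.map (proj₁ (φ≐A t)) (proj₁ (ψ≐B t)) ,
    Sum.map (proj₂ (φ≐A t)) (proj₂ (ψ≐B t))

  ⟦bᶠ∧ᶠ⟧ : ∀ b {φ A} → ⟦ φ ⟧ V ≐ A → ⟦ bᶠ b ∧ᶠ φ ⟧ V ≐ (A ∣ᵇ b)
  ⟦bᶠ∧ᶠ⟧ b φ≐A t =
    (λ { (lift hb , p) → proj₁ (φ≐A t) p , hb }) ,
    (λ { (a , hb) → lift hb , proj₂ (φ≐A t) a })

  ⟦⌢ᶠ⟧ : ∀ {φ ψ A B} → ⟦ φ ⟧ V ≐ A → ⟦ ψ ⟧ V ≐ B → ⟦ φ ⌢ᶠ ψ ⟧ V ≐ chopT A B
  ⟦⌢ᶠ⟧ φ≐A ψ≐B t =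
    (λ { (σA , s , σB , ta , lift split , p , q , lift glue) →
         σA , s , σB , ta , split , proj₁ (φ≐A ta) p , proj₁ (ψ≐B _) q , glue }) ,
    (λ { (σA , s , σB , ta , split , a , b , glue) →
         σA , s , σB , ta , lift split , proj₂ (φ≐A ta) a , proj₂ (ψ≐B _) b , lift glue })

  ⟦Id⌢ᶠ⟧ : ∀ {φ A} → ⟦ φ ⟧ V ≐ A → ⟦ rel Id ⌢ᶠ φ ⟧ V ≐ ♯ A
  ⟦Id⌢ᶠ⟧ {φ} {A} φ≐A t = to t , from t
    where
    to : ∀ t → ⟦ rel Id ⌢ᶠ φ ⟧ V t → ♯ A t
    to (_ ∷ _) (σA , s , σB , _ , lift split , lift (s₀ , _ , refl , refl) , q , lift glue)
      with ∷ʳ-injective (s₀ ∷ []) σA split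
    ... | refl , refl with glue
    ... | refl = s₀ , σB , proj₁ (φ≐A _) q , refl
    from : ∀ t → ♯ A t → ⟦ rel Id ⌢ᶠ φ ⟧ V t
    from _ (s , σ , a , refl) =
      s ∷ [] , s , σ , s ∷ s ∷ [] , lift refl , lift (s , s , refl , refl) ,
      proj₂ (φ≐A _) a , lift refl

  stf̂-sound : ∀ {ρ : Interp k} → (∀ m → V (X m) ≡ ρ m) →
    (S : Stmt k) → ⟦ stf̂ S ⟧ V ≐ 𝒮tr⟦ S ⟧ ρ
  stf̂-sound V≡ρ skip = ⟦rel-graph⟧ λ s → s
  stf̂-sound V≡ρ (x ≔ a) = ⟦rel-graph⟧ λ s → s [ x ↦ 𝒜⟦ a ⟧ s ]
  stf̂-sound V≡ρ (S₁ ⨾ S₂) = ⟦⌢ᶠ⟧ (stf̂-sound V≡ρ S₁) (stf̂-sound V≡ρ S₂)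
  stf̂-sound V≡ρ (ifS b then S₁ else S₂) =
    ⟦∨ᶠ⟧ {φ = bᶠ b ∧ᶠ (rel Id ⌢ᶠ stf̂ S₁)} {ψ = bᶠ (¬ₑ b) ∧ᶠ (rel Id ⌢ᶠ stf̂ S₂)}
      (⟦bᶠ∧ᶠ⟧ b      {φ = rel Id ⌢ᶠ stf̂ S₁} (⟦Id⌢ᶠ⟧ (stf̂-sound V≡ρ S₁)))
      (⟦bᶠ∧ᶠ⟧ (¬ₑ b) {φ = rel Id ⌢ᶠ stf̂ S₂} (⟦Id⌢ᶠ⟧ (stf̂-sound V≡ρ S₂)))
  stf̂-sound V≡ρ (call m) = ⟦var⟧ (V≡ρ m)

mainTheorem15 : (k : ℕ) (P : Program k) (ρ : Interp k) (Vρ : Valuation k) →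
    (∀ m → Vρ (X m) ≡ ρ m) →
    (S : Stmt k) → ⟦ stf̂ S ⟧ Vρ ≐ 𝒮tr⟦ S ⟧ ρ
mainTheorem15 k P ρ Vρ Vρ≡ρ = stf̂-sound Vρ Vρ≡ρ
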